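{- Let $k\geq0$ be an integer and let $n$ be a nonnegative integer. Then $\delta_k(n)=n-\partial^k(n)-\partial_k(\partial^k(n))$.
   Context: For integers $k\geq0$ and $N\geq1$ write uniquely $N=\binom{a_{k+1}}{k+1}+\binom{a_k}{k}+\cdots+\binom{a_i}{i}$ with $a_{k+1}>a_k>\cdots>a_i\geq i\geq1$, and define $\partial_k(N)=\sum_{t=i}^{k+1}\binom{a_t}{t-1}$, $\partial^k(N)=\sum_{t=i}^{k+1}\binom{a_t-1}{t}$, and $\delta_k(N)=\#\{t\in\{i,\ldots,k+1\}:a_t=t\}$ (binomials $\binom{p}{q}$ with $0\le p<q$ are $0$); set $\partial_k(0)=\partial^k(0)=\delta_k(0)=0$. -}

module Defs where

open import Data.Nat using (ℕ; zero; suc; _+_; _∸_; _≤_; _<_)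
open import Data.Nat.Combinatorics using (_C_)
open import Relation.Binary.PropositionalEquality using (_≡_)
open import Relation.Nullary.Decidable using (⌊_⌋)
open import Data.Nat using (_≟_)

sumFrom : ℕ → ℕ → (ℕ → ℕ) → ℕ
sumFrom i zero    f = 0
sumFrom i (suc m) f = f i + sumFrom (suc i) m f

-- Σ_{t=i}^{j} f t   (empty if j < i)
sumRange : ℕ → ℕ → (ℕ → ℕ) → ℕ
sumRange i j f = sumFrom i (suc j ∸ i) f

-- A (k+1)-binomial (cascade) representation of N ≥ 1:
-- N = C(a_{k+1},k+1) + C(a_k,k) + ... + C(a_i,i), a_{k+1} > ... > a_i ≥ i ≥ 1.
-- The sequence a is given as a function; only its values on [i, k+1] matter.
record Rep (k N : ℕ) : Set where
  field
    i      : ℕ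
    a      : ℕ → ℕ
    1≤i    : 1 ≤ i
    i≤k+1  : i ≤ suc k
    a≥t    : ∀ t → i ≤ t → t ≤ suc k → t ≤ a t
    decr   : ∀ t → i ≤ t → t < suc k → a t < a (suc t)
    sumEq  : N ≡ sumRange i (suc k) (λ t → a t C t)

data Decomp (k : ℕ) : ℕ → Set where
  zeroD : Decomp k 0
  repD  : ∀ {N} → Rep k N → Decomp k N

-- ∂_k(N) = Σ_t C(a_t, t-1)
lowerShadow : ∀ {k N} → Decomp k N → ℕ
lowerShadow zeroD = 0
lowerShadow {k} (repD r) = sumRange (Rep.i r) (suc k) (λ t → Rep.a r t C (t ∸ 1))

-- ∂^k(N) = Σ_t C(a_t - 1, t)
upperShadow : ∀ {k N} → Decomp k N → ℕ
upperShadow zeroD = 0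
upperShadow {k} (repD r) = sumRange (Rep.i r) (suc k) (λ t → (Rep.a r t ∸ 1) C t)

delta : ∀ {k N} → Decomp k N → ℕ
delta zeroD = 0
delta {k} (repD r) = sumRange (Rep.i r) (suc k) (λ t → if ⌊ Rep.a r t ≟ t ⌋ then 1 else 0)
  where
  open import Data.Bool using (if_then_else_)

-- Pascal's rule splits each term C(a_t, t) of the cascade of n into C(a_t - 1, t) and
-- C(a_t - 1, t - 1), except that a diagonal term C(t, t) = 1 is counted by δ instead.
-- Since a_t - t is nondecreasing, the diagonal indices form an initial segment [i, j), and
-- the remaining values a_t - 1 (t ∈ [j, k+1]) are again a cascade; its sum is ∂^k(n), so by
-- uniqueness of cascade representations ∂_k(∂^k(n)) = Σ_{t ≥ j} C(a_t - 1, t - 1).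
module Submission where

open import Defs
open import Data.Nat using (ℕ; zero; suc; _+_; _∸_; _≤_; _<_; z≤n; s≤s; s≤s⁻¹; _≟_; _<?_)
open import Data.Nat.Properties
open import Data.Nat.Combinatorics using (_C_; nCk+nC[k+1]≡[n+1]C[k+1]; k>n⇒nCk≡0; nCn≡1)
open import Algebra.Properties.CommutativeSemigroup +-commutativeSemigroup using (interchange)
open import Data.Product using (_×_; _,_; proj₁; proj₂)
open import Data.Sum using (inj₁; inj₂)
open import Data.Bool using (if_then_else_)
open import Relation.Nullary using (Dec; yes; no; ¬_; contradiction)
open import Relation.Nullary.Decidable using (⌊_⌋)
open import Relation.Unary using (Pred; Decidable)
open import Relation.Binary.Definitions using (tri<; tri≈; tri>)
open import Relation.Binary.PropositionalEquality

private
  variable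
    a b : ℕ → ℕ
    f g : ℕ → ℕ
    i j m n k N : ℕ

0<nCk : k ≤ n → 0 < n C k
0<nCk {zero}          _         = s≤s z≤n
0<nCk {suc k} {suc n} (s≤s k≤n) =
  subst (0 <_) (nCk+nC[k+1]≡[n+1]C[k+1] n k) (<-≤-trans (0<nCk k≤n) (m≤m+n _ _))

nCk≤[1+n]Ck : ∀ n k → n C k ≤ suc n C k
nCk≤[1+n]Ck n zero    = ≤-refl
nCk≤[1+n]Ck n (suc k) = subst (n C suc k ≤_) (nCk+nC[k+1]≡[n+1]C[k+1] n k) (m≤n+m _ _)

C-monoˡ-≤ : ∀ k → m ≤ n → m C k ≤ n C k
C-monoˡ-≤ k m≤n with m≤n⇒m<n∨m≡n m≤n
... | inj₂ refl              = ≤-refl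
... | inj₁ (s≤s {n = n} m≤n′) = ≤-trans (C-monoˡ-≤ k m≤n′) (nCk≤[1+n]Ck n k)

[n∸1]Cn≡0 : 1 ≤ n → (n ∸ 1) C n ≡ 0
[n∸1]Cn≡0 {suc n} (s≤s z≤n) = k>n⇒nCk≡0 {n} ≤-refl

diag : ℕ → ℕ → ℕ
diag m t = if ⌊ m ≟ t ⌋ then 1 else 0

offDiag : ℕ → ℕ → ℕ
offDiag m t = if ⌊ m ≟ t ⌋ then 0 else (m ∸ 1) C (t ∸ 1)

offDiag-diag : ∀ m → offDiag m m ≡ 0
offDiag-diag m with m ≟ m
... | yes _   = refl
... | no m≢m = contradiction refl m≢m

offDiag-< : ∀ {m t} → t < m → offDiag m t ≡ (m ∸ 1) C (t ∸ 1)
offDiag-< {m} {t} t<m with m ≟ t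
... | yes refl = contradiction t<m (n≮n t)
... | no _     = refl

pascal-split : ∀ {m t} → 1 ≤ t → t ≤ m → m C t ≡ diag m t + (m ∸ 1) C t + offDiag m t
pascal-split {suc m} {suc t} _ _ with suc m ≟ suc t
... | yes refl = trans (nCn≡1 (suc t)) (cong (λ x → 1 + x + 0) (sym ([n∸1]Cn≡0 {suc t} (s≤s z≤n))))
... | no _     = trans (sym (nCk+nC[k+1]≡[n+1]C[k+1] m t)) (+-comm (m C t) (m C suc t))

sumFrom-snoc : ∀ i m f → sumFrom i (suc m) f ≡ sumFrom i m f + f (i + m)
sumFrom-snoc i zero    f rewrite +-identityʳ i = +-comm (f i) 0
sumFrom-snoc i (suc m) f rewrite +-suc i m | sumFrom-snoc (suc i) m f =
  sym (+-assoc (f i) (sumFrom (suc i) m f) _)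

sumRange-top : i ≤ suc n → sumRange i (suc n) f ≡ sumRange i n f + f (suc n)
sumRange-top {i} {n} {f} i≤1+n rewrite +-∸-assoc 1 i≤1+n =
  trans (sumFrom-snoc i (suc n ∸ i) f) (cong (λ x → sumRange i n f + f x) (m+[n∸m]≡n i≤1+n))

sumRange-bottom : i ≤ n → sumRange i n f ≡ f i + sumRange (suc i) n f
sumRange-bottom i≤n rewrite +-∸-assoc 1 i≤n = refl

sumRange-empty : ∀ n f → sumRange (suc n) n f ≡ 0
sumRange-empty n f rewrite n∸n≡0 n = refl

sumFrom-cong : ∀ i m → (∀ {t} → i ≤ t → t < i + m → f t ≡ g t) → sumFrom i m f ≡ sumFrom i m g
sumFrom-cong i zero    eq = refl
sumFrom-cong i (suc m) eq =
  cong₂ _+_ (eq ≤-refl (m<m+n i (s≤s z≤n)))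
            (sumFrom-cong (suc i) m (λ {t} i<t t< → eq (<⇒≤ i<t) (subst (t <_) (sym (+-suc i m)) t<)))

sumRange-cong : i ≤ suc n → (∀ {t} → i ≤ t → t ≤ n → f t ≡ g t) → sumRange i n f ≡ sumRange i n g
sumRange-cong {i} {n} i≤1+n eq =
  sumFrom-cong i (suc n ∸ i) (λ {t} i≤t t< → eq i≤t (s≤s⁻¹ (subst (t <_) (m+[n∸m]≡n i≤1+n) t<)))

sumFrom-+ : ∀ i m f g → sumFrom i m (λ t → f t + g t) ≡ sumFrom i m f + sumFrom i m g
sumFrom-+ i zero    f g = refl
sumFrom-+ i (suc m) f g =
  trans (cong (f i + g i +_) (sumFrom-+ (suc i) m f g))
        (interchange (f i) (g i) (sumFrom (suc i) m f) (sumFrom (suc i) m g))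

sumRange-+ : ∀ i n f g → sumRange i n (λ t → f t + g t) ≡ sumRange i n f + sumRange i n g
sumRange-+ i n = sumFrom-+ i (suc n ∸ i)

sumRange-dropZeros : i ≤ j → j ≤ suc n → (∀ {t} → i ≤ t → t < j → f t ≡ 0) →
                     sumRange i n f ≡ sumRange j n f
sumRange-dropZeros {i} {n = n} {f = f} i≤j j≤1+n vanish with m≤n⇒m<n∨m≡n i≤j
... | inj₂ refl                 = refl
... | inj₁ (s≤s {n = j} i≤j′) = begin
  sumRange i n f                ≡⟨ sumRange-dropZeros i≤j′ (<⇒≤ j≤1+n) (λ i≤t t<j → vanish i≤t (m<n⇒m<1+n t<j)) ⟩
  sumRange j n f                ≡⟨ sumRange-bottom (s≤s⁻¹ j≤1+n) ⟩
  f j + sumRange (suc j) n f    ≡⟨ cong (_+ sumRange (suc j) n f) (vanish i≤j′ ≤-refl) ⟩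
  sumRange (suc j) n f          ∎
  where open ≡-Reasoning

-- Unlike Rep, the range [i, n] may be empty (i ≡ suc n); the empty cascade represents 0.
record IsCascade (a : ℕ → ℕ) (i n : ℕ) : Set where
  field
    1≤i        : 1 ≤ i
    i≤1+n      : i ≤ suc n
    t≤a        : ∀ {t} → i ≤ t → t ≤ n → t ≤ a t
    increasing : ∀ {t} → i ≤ t → t < n → a t < a (suc t)
open IsCascade

cascade : (ℕ → ℕ) → ℕ → ℕ → ℕ
cascade a i n = sumRange i n (λ t → a t C t)

IsCascade-init : IsCascade a i (suc n) → i ≤ suc n → IsCascade a i n
IsCascade-init c i≤1+n = record
  { 1≤i = 1≤i c ; i≤1+n = i≤1+n
  ; t≤a = λ i≤t t≤n → t≤a c i≤t (m≤n⇒m≤1+n t≤n)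
  ; increasing = λ i≤t t<n → increasing c i≤t (m<n⇒m<1+n t<n) }

cascade-≥-top : IsCascade a i n → i ≤ n → a n C n ≤ cascade a i n
cascade-≥-top {n = zero}  c i≤0   = contradiction (≤-trans (1≤i c) i≤0) λ ()
cascade-≥-top {n = suc n} c i≤1+n = subst (_ ≤_) (sym (sumRange-top i≤1+n)) (m≤n+m _ _)

cascade-pos : IsCascade a i n → i ≤ n → 0 < cascade a i n
cascade-pos c i≤n = <-≤-trans (0<nCk (t≤a c i≤n ≤-refl)) (cascade-≥-top c i≤n)

-- The classical bound behind uniqueness: by Pascal's rule C(a_n + 1, n) telescopes down the cascade.
cascade-<-next : IsCascade a i n → i ≤ n → cascade a i n < suc (a n) C n
cascade-<-next {n = zero}          c i≤0   = contradiction (≤-trans (1≤i c) i≤0) λ ()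
cascade-<-next {a} {i} {suc n} c i≤1+n = begin-strict
  cascade a i (suc n)                 ≡⟨ sumRange-top i≤1+n ⟩
  cascade a i n + A C suc n           <⟨ +-monoˡ-< (A C suc n) below ⟩
  A C n + A C suc n                   ≡⟨ nCk+nC[k+1]≡[n+1]C[k+1] A n ⟩
  suc A C suc n                       ∎
  where
  open ≤-Reasoning
  A : ℕ
  A = a (suc n)
  below : cascade a i n < A C n
  below with m≤n⇒m<n∨m≡n i≤1+n
  ... | inj₁ (s≤s i≤n) = <-≤-trans (cascade-<-next (IsCascade-init c i≤1+n) i≤n)
                                   (C-monoˡ-≤ n (increasing c i≤n ≤-refl))
  ... | inj₂ refl      = subst (_< A C n) (sym (sumRange-empty n _))
                               (0<nCk (<⇒≤ (t≤a c ≤-refl ≤-refl)))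

cascade-<-of-top : IsCascade a i n → IsCascade b j n → i ≤ n → j ≤ n → a n < b n →
                   cascade a i n < cascade b j n
cascade-<-of-top {n = n} ca cb i≤n j≤n an<bn =
  <-≤-trans (cascade-<-next ca i≤n) (≤-trans (C-monoˡ-≤ n an<bn) (cascade-≥-top cb j≤n))

cascade-top-unique : IsCascade a i n → IsCascade b j n → i ≤ n → j ≤ n →
                     cascade a i n ≡ cascade b j n → a n ≡ b n
cascade-top-unique {a} {n = n} {b} ca cb i≤n j≤n eq with <-cmp (a n) (b n)
... | tri< an<bn _ _ = contradiction (cascade-<-of-top ca cb i≤n j≤n an<bn) (<-irrefl eq)
... | tri≈ _ an≡bn _ = an≡bn
... | tri> _ _ bn<an = contradiction (cascade-<-of-top cb ca j≤n i≤n bn<an) (<-irrefl (sym eq))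

cascade-unique : IsCascade a i n → IsCascade b j n → cascade a i n ≡ cascade b j n →
                 i ≡ j × (∀ {t} → i ≤ t → t ≤ n → a t ≡ b t)
cascade-unique-nonempty : IsCascade a i n → IsCascade b j n → i ≤ n → j ≤ n →
                          cascade a i n ≡ cascade b j n → i ≡ j × (∀ {t} → i ≤ t → t ≤ n → a t ≡ b t)

cascade-unique {n = n} ca cb eq with m≤n⇒m<n∨m≡n (i≤1+n ca) | m≤n⇒m<n∨m≡n (i≤1+n cb)
... | inj₂ refl      | inj₂ refl      = refl , λ i≤t t≤n → contradiction (≤-trans i≤t t≤n) 1+n≰n
... | inj₂ refl      | inj₁ (s≤s j≤n) =
  contradiction (cascade-pos cb j≤n) (<-irrefl (trans (sym (sumRange-empty n _)) eq))
... | inj₁ (s≤s i≤n) | inj₂ refl      =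
  contradiction (cascade-pos ca i≤n) (<-irrefl (trans (sym (sumRange-empty n _)) (sym eq)))
... | inj₁ (s≤s i≤n) | inj₁ (s≤s j≤n) = cascade-unique-nonempty ca cb i≤n j≤n eq

cascade-unique-nonempty {n = zero} ca _ i≤0 _ _ = contradiction (≤-trans (1≤i ca) i≤0) λ ()
cascade-unique-nonempty {a} {i} {suc n} {b} {j} ca cb i≤1+n j≤1+n eq =
  proj₁ ih , agree
  where
  top : a (suc n) ≡ b (suc n)
  top = cascade-top-unique ca cb i≤1+n j≤1+n eq
  lower-eq : cascade a i n ≡ cascade b j n
  lower-eq = +-cancelʳ-≡ (a (suc n) C suc n) _ _ (begin
    cascade a i n + a (suc n) C suc n  ≡⟨ sym (sumRange-top i≤1+n) ⟩
    cascade a i (suc n)                ≡⟨ eq ⟩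
    cascade b j (suc n)                ≡⟨ sumRange-top j≤1+n ⟩
    cascade b j n + b (suc n) C suc n  ≡⟨ cong (λ x → cascade b j n + x C suc n) (sym top) ⟩
    cascade b j n + a (suc n) C suc n  ∎)
    where open ≡-Reasoning
  ih : i ≡ j × (∀ {t} → i ≤ t → t ≤ n → a t ≡ b t)
  ih = cascade-unique (IsCascade-init ca i≤1+n) (IsCascade-init cb j≤1+n) lower-eq
  agree : ∀ {t} → i ≤ t → t ≤ suc n → a t ≡ b t
  agree i≤t t≤1+n with m≤n⇒m<n∨m≡n t≤1+n
  ... | inj₁ (s≤s t≤n) = proj₂ ih i≤t t≤n
  ... | inj₂ refl      = top

record Threshold {p} (P : Pred ℕ p) (i m : ℕ) : Set p where
  field
    cut     : ℕ
    i≤cut   : i ≤ cut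
    cut≤m   : cut ≤ m
    below   : ∀ {t} → i ≤ t → t < cut → ¬ P t
    above   : ∀ {t} → cut ≤ t → t < m → P t

module _ {p} {P : Pred ℕ p} where

  UpwardClosedOn : ℕ → ℕ → Set p
  UpwardClosedOn i m = ∀ {t} → i ≤ t → suc t < m → P t → P (suc t)

  threshold-empty : Threshold P m m
  threshold-empty {m} = record
    { cut = m ; i≤cut = ≤-refl ; cut≤m = ≤-refl
    ; below = λ m≤t t<m → contradiction m≤t (<⇒≱ t<m)
    ; above = λ m≤t t<m → contradiction m≤t (<⇒≱ t<m) }

  threshold-extend : Dec (P m) → UpwardClosedOn i (suc m) → Threshold P i m → Threshold P i (suc m)
  threshold-extend {m} {i} (yes Pm) _ T = record
    { cut = cut ; i≤cut = i≤cut ; cut≤m = m≤n⇒m≤1+n cut≤m ; below = below ; above = above′ }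
    where
    open Threshold T
    above′ : ∀ {t} → cut ≤ t → t < suc m → P t
    above′ cut≤t t<1+m with m<1+n⇒m<n∨m≡n t<1+m
    ... | inj₁ t<m = above cut≤t t<m
    ... | inj₂ refl = Pm
  threshold-extend {m} {i} (no ¬Pm) up T with m≤n⇒m<n∨m≡n (Threshold.cut≤m T)
  ... | inj₁ (s≤s {n = m′} cut≤m′) =
    contradiction (up (≤-trans (Threshold.i≤cut T) cut≤m′) ≤-refl (Threshold.above T cut≤m′ ≤-refl))
                  ¬Pm
  ... | inj₂ refl = record
    { cut = suc m ; i≤cut = m≤n⇒m≤1+n (Threshold.i≤cut T) ; cut≤m = ≤-refl ; below = below′
    ; above = λ 1+m≤t t<1+m → contradiction 1+m≤t (<⇒≱ t<1+m) }
    where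
    below′ : ∀ {t} → i ≤ t → t < suc m → ¬ P t
    below′ i≤t t<1+m with m<1+n⇒m<n∨m≡n t<1+m
    ... | inj₁ t<m = Threshold.below T i≤t t<m
    ... | inj₂ refl = ¬Pm

  threshold : Decidable P → ∀ m → i ≤ m → UpwardClosedOn i m → Threshold P i m
  threshold P? m i≤m up with m≤n⇒m<n∨m≡n i≤m
  ... | inj₂ refl = threshold-empty
  ... | inj₁ (s≤s {n = m′} i≤m′) =
    threshold-extend (P? m′) up (threshold P? m′ i≤m′ (λ i≤t t<m′ → up i≤t (m<n⇒m<1+n t<m′)))

cascade-pascal : IsCascade a i n →
                 cascade a i n ≡ sumRange i n (λ t → diag (a t) t) + sumRange i n (λ t → (a t ∸ 1) C t)
                                 + sumRange i n (λ t → offDiag (a t) t)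
cascade-pascal {a} {i} {n} c = begin
  cascade a i n
    ≡⟨ sumRange-cong (i≤1+n c) (λ i≤t t≤n → pascal-split (≤-trans (1≤i c) i≤t) (t≤a c i≤t t≤n)) ⟩
  sumRange i n (λ t → diag (a t) t + (a t ∸ 1) C t + offDiag (a t) t)
    ≡⟨ sumRange-+ i n _ _ ⟩
  sumRange i n (λ t → diag (a t) t + (a t ∸ 1) C t) + sumRange i n (λ t → offDiag (a t) t)
    ≡⟨ cong (_+ sumRange i n (λ t → offDiag (a t) t)) (sumRange-+ i n _ _) ⟩
  _ ∎
  where open ≡-Reasoning

diagonalPrefix : IsCascade a i n → Threshold (λ t → t < a t) i (suc n)
diagonalPrefix {a} {n = n} c =
  threshold (λ t → t <? a t) (suc n) (i≤1+n c)
            (λ i≤t 1+t<1+n t<at → ≤-<-trans t<at (increasing c i≤t (s≤s⁻¹ 1+t<1+n)))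

module Shift {a i n} (c : IsCascade a i n) where
  open Threshold (diagonalPrefix c)

  diagonal : ∀ {t} → i ≤ t → t < cut → a t ≡ t
  diagonal i≤t t<cut = ≤-antisym (≮⇒≥ (below i≤t t<cut)) (t≤a c i≤t (s≤s⁻¹ (<-≤-trans t<cut cut≤m)))

  shifted : IsCascade (λ t → a t ∸ 1) cut n
  shifted = record
    { 1≤i = ≤-trans (1≤i c) i≤cut ; i≤1+n = cut≤m
    ; t≤a = λ cut≤t t≤n → ∸-monoˡ-≤ 1 (above cut≤t (s≤s t≤n))
    ; increasing = λ cut≤t t<n →
        ∸-monoˡ-< (increasing c (≤-trans i≤cut cut≤t) t<n) (≤-trans (s≤s z≤n) (above cut≤t (m<n⇒m<1+n t<n))) }

  upperSum-shifted : sumRange i n (λ t → (a t ∸ 1) C t) ≡ cascade (λ t → a t ∸ 1) cut n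
  upperSum-shifted = sumRange-dropZeros i≤cut cut≤m vanish
    where
    vanish : ∀ {t} → i ≤ t → t < cut → (a t ∸ 1) C t ≡ 0
    vanish {t} i≤t t<cut rewrite diagonal i≤t t<cut = [n∸1]Cn≡0 (≤-trans (1≤i c) i≤t)

  offDiagSum-shifted : sumRange i n (λ t → offDiag (a t) t) ≡ sumRange cut n (λ t → (a t ∸ 1) C (t ∸ 1))
  offDiagSum-shifted = trans
    (sumRange-dropZeros i≤cut cut≤m λ {t} i≤t t<cut →
       subst (λ x → offDiag x t ≡ 0) (sym (diagonal i≤t t<cut)) (offDiag-diag t))
    (sumRange-cong cut≤m (λ cut≤t t≤n → offDiag-< (above cut≤t (s≤s t≤n))))

rep-cascade : (r : Rep k N) → IsCascade (Rep.a r) (Rep.i r) (suc k)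
rep-cascade r = record
  { 1≤i = Rep.1≤i r ; i≤1+n = m≤n⇒m≤1+n (Rep.i≤k+1 r) ; t≤a = Rep.a≥t r _ ; increasing = Rep.decr r _ }

cascade-zero : IsCascade a i n → cascade a i n ≡ 0 → i ≡ suc n
cascade-zero c eq with m≤n⇒m<n∨m≡n (i≤1+n c)
... | inj₁ (s≤s i≤n) = contradiction (cascade-pos c i≤n) (<-irrefl (sym eq))
... | inj₂ i≡1+n     = i≡1+n

lowerShadow-zero : (e : Decomp k 0) → lowerShadow e ≡ 0
lowerShadow-zero zeroD    = refl
lowerShadow-zero (repD r) = contradiction (cascade-pos (rep-cascade r) (Rep.i≤k+1 r)) (<-irrefl (Rep.sumEq r))

lowerShadow-cascade : IsCascade b j (suc k) → N ≡ cascade b j (suc k) → (e : Decomp k N) →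
                      lowerShadow e ≡ sumRange j (suc k) (λ t → b t C (t ∸ 1))
lowerShadow-cascade {k = k} cb N≡ zeroD with cascade-zero cb (sym N≡)
... | refl = sym (sumRange-empty (suc k) _)
lowerShadow-cascade cb N≡ (repD r) with cascade-unique (rep-cascade r) cb (trans (sym (Rep.sumEq r)) N≡)
... | refl , agree = sumRange-cong (i≤1+n cb) (λ {t} i≤t t≤1+k → cong (_C (t ∸ 1)) (agree i≤t t≤1+k))

lemma2p4 : (k n : ℕ) (d : Decomp k n) (e : Decomp k (upperShadow d))
           → delta d + upperShadow d + lowerShadow e ≡ n
lemma2p4 k .0 zeroD    e = lowerShadow-zero e
lemma2p4 k n  (repD r) e = begin
  δ + ∂ + lowerShadow e
    ≡⟨ cong (δ + ∂ +_) (lowerShadow-cascade shifted upperSum-shifted e) ⟩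
  δ + ∂ + sumRange cut (suc k) (λ t → (aᵣ t ∸ 1) C (t ∸ 1))
    ≡⟨ cong (δ + ∂ +_) (sym offDiagSum-shifted) ⟩
  δ + ∂ + sumRange iᵣ (suc k) (λ t → offDiag (aᵣ t) t)
    ≡⟨ sym (cascade-pascal c) ⟩
  cascade aᵣ iᵣ (suc k)
    ≡⟨ sym (Rep.sumEq r) ⟩
  n ∎
  where
  open ≡-Reasoning
  open Rep r using () renaming (i to iᵣ; a to aᵣ)
  c : IsCascade aᵣ iᵣ (suc k)
  c = rep-cascade r
  open Shift c
  open Threshold (diagonalPrefix c) using (cut)
  δ ∂ : ℕ
  δ = delta (repD r)
  ∂ = upperShadow (repD r)
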